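{- Let $X=[n]$ be the disjoint union of sets $X_1$ and $X_2$. Let $A_1,\dots,A_m,B_1,\dots,B_m\subseteq X$ be such that $\mathcal{P}=\{(A_i,B_i)\mid i\in[m]\}$ is a Bollobás system. Then $$\sum_{i=1}^m \left(\binom{|A_i\cap X_1|+|B_i\cap X_1|}{|A_i\cap X_1|}\binom{|A_i\cap X_2|+|B_i\cap X_2|}{|A_i\cap X_2|}\right)^{ -1} \le 1+\left\lfloor \frac{n}{2}\right\rfloor.$$
   Context: A family of pairs of sets $\mathcal{P}=\{(A_i,B_i)\mid i\in[m]\}$ is called a Bollobás system if for all $i,j\in[m]$: $A_i\cap B_j=\emptyset$ if and only if $i=j$. Here $[n]=\{1,\dots,n\}$. -}

module Defs where

open import Data.Nat using (ℕ; zero; suc; _+_; _/_)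
open import Data.Nat.Combinatorics using (_C_)
open import Data.Fin using (Fin)
open import Data.Fin.Subset using (Subset; _∩_; ∣_∣; Empty)
open import Data.List using (List; map; foldr)
open import Data.List using (allFin)
open import Data.Integer using (+_)
open import Data.Rational as ℚ using (ℚ; 0ℚ)
open import Relation.Binary.PropositionalEquality using (_≡_)
open import Relation.Nullary using (¬_)
open import Data.Product using (_×_)

IsBollobas : ∀ {n m} → (Fin m → Subset n) → (Fin m → Subset n) → Set
IsBollobas {m = m} A B =
  (∀ i → Empty (A i ∩ B i)) × (∀ (i j : Fin m) → Empty (A i ∩ B j) → i ≡ j)

-- reciprocal of a natural number as a rational (value at 0 is irrelevant:
-- only applied to products of binomial coefficients, which are ≥ 1)
recip : ℕ → ℚ
recip zero = 0ℚ
recip (suc k) = (+ 1) ℚ./ suc k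

∑ : ∀ m → (Fin m → ℚ) → ℚ
∑ m f = foldr ℚ._+_ 0ℚ (map f (allFin m))

weight : ∀ {n} → Subset n → Subset n → Subset n → Subset n → ℚ
weight X₁ X₂ A B =
  recip (((∣ A ∩ X₁ ∣ + ∣ B ∩ X₁ ∣) C ∣ A ∩ X₁ ∣)
         Data.Nat.* ((∣ A ∩ X₂ ∣ + ∣ B ∩ X₂ ∣) C ∣ A ∩ X₂ ∣))

bound : ℕ → ℚ
bound n = (+ (1 + n / 2)) ℚ./ 1

-- Write Cₖ(A,B) = C(|A∩Sₖ|+|B∩Sₖ|, |A∩Sₖ|).  We prove, by induction on |S₂|, that
-- Σᵢ 1/(C₁(Aᵢ,Bᵢ)·C₂(Aᵢ,Bᵢ)) ≤ 1 + |S₂| for every family of disjoint pairs in which Aᵢ ∩ Bⱼ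
-- meets S₁ ∪ S₂ whenever i ≠ j.  The engine is the deletion identity for a single part S:
--   Σ_{x ∈ S, x ∉ A or B ∩ S = ∅} 1/C(S - x) = |S|/C(S),
-- a consequence of the absorption identity (b+1)·C(a+b+1,a) = (a+b+1)·C(a+b,a).  Multiplying
-- the sum by |S₂| and exchanging the order of summation, for each x ∈ S₂ the surviving pairs
-- split into those with x ∉ A, which cross-intersect inside S₁ ∪ (S₂ - x) (induction), and
-- those with B ∩ S₂ = ∅, which cross-intersect inside S₁ and contribute at most 1 by the same
-- averaging applied to S₁ alone (Bollobás's inequality).  Applied to (X₁,X₂) and (X₂,X₁) this
-- bounds the sum by 1 + min(|X₁|,|X₂|) ≤ 1 + ⌊n/2⌋.

module Submission where

open import Data.Bool using (Bool; true; false; T; _∧_; _∨_; not)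
open import Data.Bool.Properties using (∧-zeroʳ; ∧-identityʳ; ∨-identityʳ; T-∧; T-not-≡)
open import Data.Fin using (Fin; zero; suc)
import Data.Fin.Properties as Fin
open import Data.Fin.Subset
open import Data.Fin.Subset.Properties
open import Data.Integer as ℤ using ()
import Data.Integer.Properties as ℤ
import Data.List as List
import Data.List.Properties as List
open import Data.Nat as ℕ using (ℕ; zero; suc)
open import Data.Nat.Combinatorics using (_C_; nCn≡1)
import Data.Nat.DivMod as ℕ
import Data.Nat.Properties as ℕ
open import Data.Product using (_,_; proj₁; _×_; ∃-syntax)
open import Data.Rational.Unnormalised as ℚᵘ using (mkℚᵘ; *≡*; *≤*)
import Data.Rational.Unnormalised.Properties as ℚᵘ
open import Data.Sum as Sum using (inj₁; inj₂)
open import Data.Vec using ([]; _∷_; lookup; here; there)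
open import Data.Vec.Properties using (lookup-zipWith; lookup-map; lookup⇒[]=; []=⇒lookup)
open import Function using (_∘_; id)
open import Function.Bundles using (Equivalence)
open import Algebra.Bundles using (CommutativeRing; CommutativeMonoid)
open import Relation.Binary.PropositionalEquality
open import Relation.Nullary using (contradiction; yes; no)
import Relation.Binary.Reasoning.Setoid ℚᵘ.≃-setoid as ≃-Reasoning

open import Defs

module Binomial where

  open import Data.Nat
  open import Data.Nat.Combinatorics
  open import Data.Nat.DivMod using (m/n*n≡m)
  open import Data.Nat.Properties
  open import Data.Nat.Tactic.RingSolver using (solve-∀)
  open import Relation.Binary.PropositionalEquality

  C-factorial : ∀ a b → ((a + b) C a) * (a ! * b !) ≡ (a + b) !
  C-factorial a b = begin
    ((a + b) C a) * (a ! * b !)                        ≡⟨ cong (λ k → ((a + b) C a) * (a ! * k !)) (m+n∸m≡n a b) ⟨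
    ((a + b) C a) * d                                  ≡⟨ cong (_* d) (nCk≡n!/k![n-k]! a≤a+b) ⟩
    (a + b) ! / d * d                                  ≡⟨ m/n*n≡m (k![n∸k]!∣n! a≤a+b) ⟩
    (a + b) !                                          ∎
    where
    open ≡-Reasoning
    a≤a+b = m≤m+n a b
    d = a ! * (a + b ∸ a) !
    instance _ = a !* (a + b ∸ a) !≢0

  C-nonZero : ∀ a b → (a + b) C a ≢ 0
  C-nonZero a b C≡0 =
    ≢-nonZero⁻¹ ((a + b) !) {{(a + b) !≢0}} (trans (sym (C-factorial a b)) (cong (_* (a ! * b !)) C≡0))

  C-absorption : ∀ a b → suc b * ((a + suc b) C a) ≡ (a + suc b) * ((a + b) C a)
  C-absorption a b = *-cancelʳ-≡ _ _ (a ! * b !) {{a !* b !≢0}} (begin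
    suc b * X * (a ! * b !)          ≡⟨ x*y*[z*w]≡y*[z*[x*w]] (suc b) X (a !) (b !) ⟩
    X * (a ! * (suc b * b !))        ≡⟨ C-factorial a (suc b) ⟩
    (a + suc b) !                    ≡⟨ cong _! (+-suc a b) ⟩
    suc (a + b) * (a + b) !          ≡⟨ cong₂ _*_ (+-suc a b) (C-factorial a b) ⟨
    (a + suc b) * (Y * (a ! * b !))  ≡⟨ *-assoc (a + suc b) Y (a ! * b !) ⟨
    (a + suc b) * Y * (a ! * b !)    ∎)
    where
    open ≡-Reasoning
    X = (a + suc b) C a
    Y = (a + b) C a
    x*y*[z*w]≡y*[z*[x*w]] : ∀ x y z w → x * y * (z * w) ≡ y * (z * (x * w))
    x*y*[z*w]≡y*[z*[x*w]] = solve-∀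

open Binomial using (C-nonZero; C-absorption)

open import Data.Integer.Tactic.RingSolver using (solve-∀)
open import Data.Rational as ℚ using (ℚ; 0ℚ; 1ℚ; _/_; _+_; _*_; _≤_; toℚᵘ)
open import Data.Rational.Properties as ℚ
  using (toℚᵘ-injective; toℚᵘ-fromℚᵘ; fromℚᵘ-cong; toℚᵘ-homo-+; toℚᵘ-homo-*; toℚᵘ-cancel-≤)
open import Algebra.Properties.Semiring.Sum (CommutativeRing.semiring ℚ.+-*-commutativeRing)
open import Algebra.Properties.CommutativeSemigroup
  (CommutativeMonoid.commutativeSemigroup ℚ.*-1-commutativeMonoid) using (x∙yz≈y∙xz)

ι : ℕ → ℚ
ι k = ℤ.+ k / 1

private
  ιᵘ : ∀ k → toℚᵘ (ι k) ℚᵘ.≃ mkℚᵘ (ℤ.+ k) 0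
  ιᵘ k = toℚᵘ-fromℚᵘ (mkℚᵘ (ℤ.+ k) 0)

  recipᵘ : ∀ k → toℚᵘ (recip (suc k)) ℚᵘ.≃ mkℚᵘ (ℤ.+ 1) k
  recipᵘ k = toℚᵘ-fromℚᵘ (mkℚᵘ (ℤ.+ 1) k)

ι-homo-+ : ∀ a b → ι (a ℕ.+ b) ≡ ι a + ι b
ι-homo-+ a b = toℚᵘ-injective (begin
  toℚᵘ (ι (a ℕ.+ b))                     ≈⟨ ιᵘ (a ℕ.+ b) ⟩
  mkℚᵘ (ℤ.+ (a ℕ.+ b)) 0                 ≈⟨ *≡* (cong (ℤ._* ℤ.+ 1) (trans (ℤ.pos-+ a b) (x+y≡x*1+y*1 (ℤ.+ a) (ℤ.+ b)))) ⟩
  mkℚᵘ (ℤ.+ a) 0 ℚᵘ.+ mkℚᵘ (ℤ.+ b) 0     ≈⟨ ℚᵘ.+-cong (ιᵘ a) (ιᵘ b) ⟨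
  toℚᵘ (ι a) ℚᵘ.+ toℚᵘ (ι b)             ≈⟨ toℚᵘ-homo-+ (ι a) (ι b) ⟨
  toℚᵘ (ι a + ι b)                       ∎)
  where
  open ≃-Reasoning
  x+y≡x*1+y*1 : ∀ x y → x ℤ.+ y ≡ x ℤ.* ℤ.+ 1 ℤ.+ y ℤ.* ℤ.+ 1
  x+y≡x*1+y*1 = solve-∀

ι-mono-≤ : ∀ {a b} → a ℕ.≤ b → ι a ≤ ι b
ι-mono-≤ {a} {b} a≤b = toℚᵘ-cancel-≤
  (ℚᵘ.≤-respʳ-≃ (ℚᵘ.≃-sym (ιᵘ b)) (ℚᵘ.≤-respˡ-≃ (ℚᵘ.≃-sym (ιᵘ a))
    (*≤* (ℤ.*-monoʳ-≤-nonNeg (ℤ.+ 1) (ℤ.+≤+ a≤b)))))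

ι-cancelˡ-≤ : ∀ k {p q} → ι (suc k) * p ≤ ι (suc k) * q → p ≤ q
ι-cancelˡ-≤ k = ℚ.*-cancelˡ-≤-pos (ι (suc k)) {{ℚ.normalize-pos (suc k) 1}}

ι*recip≡/ : ∀ u d → ι u * recip (suc d) ≡ ℤ.+ u / suc d
ι*recip≡/ u d = toℚᵘ-injective (begin
  toℚᵘ (ι u * recip (suc d))              ≈⟨ toℚᵘ-homo-* (ι u) (recip (suc d)) ⟩
  toℚᵘ (ι u) ℚᵘ.* toℚᵘ (recip (suc d))    ≈⟨ ℚᵘ.*-cong (ιᵘ u) (recipᵘ d) ⟩
  mkℚᵘ (ℤ.+ u) 0 ℚᵘ.* mkℚᵘ (ℤ.+ 1) d      ≈⟨ *≡* (cong₂ (λ x k → x ℤ.* ℤ.+ suc k) (ℤ.*-identityʳ (ℤ.+ u))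
                                                                                     (sym (ℕ.+-identityʳ d))) ⟩
  mkℚᵘ (ℤ.+ u) d                          ≈⟨ toℚᵘ-fromℚᵘ (mkℚᵘ (ℤ.+ u) d) ⟨
  toℚᵘ (ℤ.+ u / suc d)                    ∎)
  where open ≃-Reasoning

/-cross : ∀ u v x y → u ℕ.* suc y ≡ v ℕ.* suc x → ℤ.+ u / suc x ≡ ℤ.+ v / suc y
/-cross u v x y eq = fromℚᵘ-cong {mkℚᵘ (ℤ.+ u) x} {mkℚᵘ (ℤ.+ v) y} (*≡* (begin
  ℤ.+ u ℤ.* ℤ.+ suc y   ≡⟨ ℤ.pos-* u (suc y) ⟨
  ℤ.+ (u ℕ.* suc y)     ≡⟨ cong ℤ.+_ eq ⟩
  ℤ.+ (v ℕ.* suc x)     ≡⟨ ℤ.pos-* v (suc x) ⟩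
  ℤ.+ v ℤ.* ℤ.+ suc x   ∎))
  where open ≡-Reasoning

ι*recip-cross : ∀ u v {X Y} → X ≢ 0 → Y ≢ 0 → u ℕ.* Y ≡ v ℕ.* X → ι u * recip X ≡ ι v * recip Y
ι*recip-cross u v {zero}          X≢0 _   _  = contradiction refl X≢0
ι*recip-cross u v {suc _} {zero}  _   Y≢0 _  = contradiction refl Y≢0
ι*recip-cross u v {suc x} {suc y} _   _   eq = begin
  ι u * recip (suc x)  ≡⟨ ι*recip≡/ u x ⟩
  ℤ.+ u / suc x        ≡⟨ /-cross u v x y eq ⟩
  ℤ.+ v / suc y        ≡⟨ ι*recip≡/ v y ⟨
  ι v * recip (suc y)  ∎
  where open ≡-Reasoning

-- Holds also when a factor is 0, because recip 0 = 0.
recip-homo-* : ∀ a b → recip (a ℕ.* b) ≡ recip a * recip b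
recip-homo-* zero    b       = sym (ℚ.*-zeroˡ (recip b))
recip-homo-* (suc a) zero    = trans (cong recip (ℕ.*-zeroʳ a)) (sym (ℚ.*-zeroʳ (recip (suc a))))
recip-homo-* (suc a) (suc b) = toℚᵘ-injective (begin
  toℚᵘ (recip (suc a ℕ.* suc b))                  ≈⟨ toℚᵘ-fromℚᵘ (mkℚᵘ (ℤ.+ 1) (b ℕ.+ a ℕ.* suc b)) ⟩
  mkℚᵘ (ℤ.+ 1) a ℚᵘ.* mkℚᵘ (ℤ.+ 1) b              ≈⟨ ℚᵘ.*-cong (recipᵘ a) (recipᵘ b) ⟨
  toℚᵘ (recip (suc a)) ℚᵘ.* toℚᵘ (recip (suc b))  ≈⟨ toℚᵘ-homo-* (recip (suc a)) (recip (suc b)) ⟨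
  toℚᵘ (recip (suc a) * recip (suc b))            ∎)
  where open ≃-Reasoning

recip-nonNeg : ∀ k → 0ℚ ≤ recip k
recip-nonNeg zero    = ℚ.≤-refl
recip-nonNeg (suc k) = ℚ.nonNegative⁻¹ (recip (suc k)) {{ℚ.normalize-nonNeg 1 (suc k)}}

recip-≤1 : ∀ k → recip k ≤ 1ℚ
recip-≤1 zero    = ℚ.nonNegative⁻¹ 1ℚ
recip-≤1 (suc k) = toℚᵘ-cancel-≤ (ℚᵘ.≤-respˡ-≃ (ℚᵘ.≃-sym (recipᵘ k)) (*≤* (ℤ.+≤+ (ℕ.s≤s ℕ.z≤n))))

0*≡0*+0* : ∀ p q r → 0ℚ * p ≡ 0ℚ * q + 0ℚ * r
0*≡0*+0* p q r = trans (ℚ.*-zeroˡ p) (sym (trans (cong₂ _+_ (ℚ.*-zeroˡ q) (ℚ.*-zeroˡ r)) (ℚ.+-identityˡ 0ℚ)))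

1*≡1*+0* : ∀ {p q} r → p ≡ q → 1ℚ * p ≡ 1ℚ * q + 0ℚ * r
1*≡1*+0* {q = q} r refl = sym (trans (cong (1ℚ * q +_) (ℚ.*-zeroˡ r)) (ℚ.+-identityʳ (1ℚ * q)))

1*≡0*+1* : ∀ {p r} q → p ≡ r → 1ℚ * p ≡ 0ℚ * q + 1ℚ * r
1*≡0*+1* {r = r} q refl = sym (trans (cong (_+ 1ℚ * r) (ℚ.*-zeroˡ q)) (ℚ.+-identityˡ (1ℚ * r)))

p≤q+p : ∀ {p q} → 0ℚ ≤ q → p ≤ q + p
p≤q+p {p} {q} 0≤q = subst (_≤ q + p) (ℚ.+-identityˡ p) (ℚ.+-monoˡ-≤ p 0≤q)

lookup≡false⇒∉ : ∀ {n} {p : Subset n} {x} → lookup p x ≡ false → x ∉ p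
lookup≡false⇒∉ px≡false x∈p = contradiction (trans (sym ([]=⇒lookup x∈p)) px≡false) λ ()

x∈p⇒∣p∣≡1+∣p-x∣ : ∀ {n} {p : Subset n} {x} → x ∈ p → ∣ p ∣ ≡ suc ∣ p - x ∣
x∈p⇒∣p∣≡1+∣p-x∣ {p = inside  ∷ p} here        = cong (λ q → suc ∣ q ∣) (sym (p─⊥≡p p))
x∈p⇒∣p∣≡1+∣p-x∣ {p = inside  ∷ p} (there x∈p) = cong suc (x∈p⇒∣p∣≡1+∣p-x∣ x∈p)
x∈p⇒∣p∣≡1+∣p-x∣ {p = outside ∷ p} (there x∈p) = x∈p⇒∣p∣≡1+∣p-x∣ x∈p

x∉p⇒p-x≡p : ∀ {n} {p : Subset n} {x} → x ∉ p → p - x ≡ p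
x∉p⇒p-x≡p {p = inside  ∷ p} {zero}  x∉p = contradiction here x∉p
x∉p⇒p-x≡p {p = outside ∷ p} {zero}  x∉p = cong (outside ∷_) (p─⊥≡p p)
x∉p⇒p-x≡p {p = s       ∷ p} {suc x} x∉p = cong (s ∷_) (x∉p⇒p-x≡p (x∉p ∘ there))

∣p∣≡0⇒x∉p : ∀ {n} {p : Subset n} {x} → ∣ p ∣ ≡ 0 → x ∉ p
∣p∣≡0⇒x∉p ∣p∣≡0 x∈p = ℕ.0≢1+n (trans (sym ∣p∣≡0) (x∈p⇒∣p∣≡1+∣p-x∣ x∈p))

∣p∣≡0⇒p≡⊥ : ∀ {n} {p : Subset n} → ∣ p ∣ ≡ 0 → p ≡ ⊥
∣p∣≡0⇒p≡⊥ ∣p∣≡0 = Empty-unique (λ (_ , x∈p) → ∣p∣≡0⇒x∉p ∣p∣≡0 x∈p)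

p∩[q─r]≡p∩q─r : ∀ {n} (p q r : Subset n) → p ∩ (q ─ r) ≡ p ∩ q ─ r
p∩[q─r]≡p∩q─r []      []      []            = refl
p∩[q─r]≡p∩q─r (a ∷ p) (b ∷ q) (inside  ∷ r) = cong₂ _∷_ (∧-zeroʳ a) (p∩[q─r]≡p∩q─r p q r)
p∩[q─r]≡p∩q─r (a ∷ p) (b ∷ q) (outside ∷ r) = cong (a ∧ b ∷_) (p∩[q─r]≡p∩q─r p q r)

x∈p∩q⇒∣p∩q∣≡1+∣p∩[q-x]∣ : ∀ {n} {p q : Subset n} {x} → x ∈ p ∩ q → ∣ p ∩ q ∣ ≡ suc ∣ p ∩ (q - x) ∣
x∈p∩q⇒∣p∩q∣≡1+∣p∩[q-x]∣ {p = p} {q} {x} x∈p∩q rewrite p∩[q─r]≡p∩q─r p q ⁅ x ⁆ = x∈p⇒∣p∣≡1+∣p-x∣ x∈p∩q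

x∉p∩q⇒∣p∩[q-x]∣≡∣p∩q∣ : ∀ {n} {p q : Subset n} {x} → x ∉ p ∩ q → ∣ p ∩ (q - x) ∣ ≡ ∣ p ∩ q ∣
x∉p∩q⇒∣p∩[q-x]∣≡∣p∩q∣ {p = p} {q} {x} x∉p∩q rewrite p∩[q─r]≡p∩q─r p q ⁅ x ⁆ = cong ∣_∣ (x∉p⇒p-x≡p x∉p∩q)

∣p∩[q-x]∣≤∣p∩q∣ : ∀ {n} (p q : Subset n) x → ∣ p ∩ (q - x) ∣ ℕ.≤ ∣ p ∩ q ∣
∣p∩[q-x]∣≤∣p∩q∣ p q x rewrite p∩[q─r]≡p∩q─r p q ⁅ x ⁆ = ∣p─q∣≤∣p∣ (p ∩ q) ⁅ x ⁆

∣p∩q∣≡0⇒∣p∩[q-x]∣≡0 : ∀ {n} (p q : Subset n) x → ∣ p ∩ q ∣ ≡ 0 → ∣ p ∩ (q - x) ∣ ≡ 0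
∣p∩q∣≡0⇒∣p∩[q-x]∣≡0 p q x ∣p∩q∣≡0 = ℕ.n≤0⇒n≡0 (subst (∣ p ∩ (q - x) ∣ ℕ.≤_) ∣p∩q∣≡0 (∣p∩[q-x]∣≤∣p∩q∣ p q x))

∣s∣≡∣p∩s∣+∣q∩s∣+∣∁[p∪q]∩s∣ : ∀ {n} {p q : Subset n} (s : Subset n) → Empty (p ∩ q) →
                             ∣ s ∣ ≡ ∣ p ∩ s ∣ ℕ.+ ∣ q ∩ s ∣ ℕ.+ ∣ ∁ (p ∪ q) ∩ s ∣
∣s∣≡∣p∩s∣+∣q∩s∣+∣∁[p∪q]∩s∣ {p = []}        {[]}        [] _ = refl
∣s∣≡∣p∩s∣+∣q∩s∣+∣∁[p∪q]∩s∣ {p = true  ∷ _} {true  ∷ _} _  e = contradiction (zero , here) e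
∣s∣≡∣p∩s∣+∣q∩s∣+∣∁[p∪q]∩s∣ {p = true  ∷ _} {false ∷ _} (true  ∷ s) e =
  cong suc (∣s∣≡∣p∩s∣+∣q∩s∣+∣∁[p∪q]∩s∣ s (drop-∷-Empty e))
∣s∣≡∣p∩s∣+∣q∩s∣+∣∁[p∪q]∩s∣ {p = false ∷ p} {true  ∷ q} (true  ∷ s) e =
  trans (cong suc (∣s∣≡∣p∩s∣+∣q∩s∣+∣∁[p∪q]∩s∣ s (drop-∷-Empty e)))
        (cong (ℕ._+ ∣ ∁ (p ∪ q) ∩ s ∣) (sym (ℕ.+-suc ∣ p ∩ s ∣ ∣ q ∩ s ∣)))
∣s∣≡∣p∩s∣+∣q∩s∣+∣∁[p∪q]∩s∣ {p = false ∷ p} {false ∷ q} (true  ∷ s) e =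
  trans (cong suc (∣s∣≡∣p∩s∣+∣q∩s∣+∣∁[p∪q]∩s∣ s (drop-∷-Empty e)))
        (sym (ℕ.+-suc (∣ p ∩ s ∣ ℕ.+ ∣ q ∩ s ∣) ∣ ∁ (p ∪ q) ∩ s ∣))
∣s∣≡∣p∩s∣+∣q∩s∣+∣∁[p∪q]∩s∣ {p = true  ∷ _} {false ∷ _} (false ∷ s) e = ∣s∣≡∣p∩s∣+∣q∩s∣+∣∁[p∪q]∩s∣ s (drop-∷-Empty e)
∣s∣≡∣p∩s∣+∣q∩s∣+∣∁[p∪q]∩s∣ {p = false ∷ _} {true  ∷ _} (false ∷ s) e = ∣s∣≡∣p∩s∣+∣q∩s∣+∣∁[p∪q]∩s∣ s (drop-∷-Empty e)
∣s∣≡∣p∩s∣+∣q∩s∣+∣∁[p∪q]∩s∣ {p = false ∷ _} {false ∷ _} (false ∷ s) e = ∣s∣≡∣p∩s∣+∣q∩s∣+∣∁[p∪q]∩s∣ s (drop-∷-Empty e)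

∣p∣+∣q∣≡∣p∪q∣+∣p∩q∣ : ∀ {n} (p q : Subset n) → ∣ p ∣ ℕ.+ ∣ q ∣ ≡ ∣ p ∪ q ∣ ℕ.+ ∣ p ∩ q ∣
∣p∣+∣q∣≡∣p∪q∣+∣p∩q∣ []          []          = refl
∣p∣+∣q∣≡∣p∪q∣+∣p∩q∣ (true  ∷ p) (true  ∷ q) =
  cong suc (trans (ℕ.+-suc _ _) (trans (cong suc (∣p∣+∣q∣≡∣p∪q∣+∣p∩q∣ p q)) (sym (ℕ.+-suc _ _))))
∣p∣+∣q∣≡∣p∪q∣+∣p∩q∣ (true  ∷ p) (false ∷ q) = cong suc (∣p∣+∣q∣≡∣p∪q∣+∣p∩q∣ p q)
∣p∣+∣q∣≡∣p∪q∣+∣p∩q∣ (false ∷ p) (true  ∷ q) = trans (ℕ.+-suc _ _) (cong suc (∣p∣+∣q∣≡∣p∪q∣+∣p∩q∣ p q))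
∣p∣+∣q∣≡∣p∪q∣+∣p∩q∣ (false ∷ p) (false ∷ q) = ∣p∣+∣q∣≡∣p∪q∣+∣p∩q∣ p q

∣p∣+∣q∣≡n : ∀ {n} {p q : Subset n} → p ∩ q ≡ ⊥ → p ∪ q ≡ ⊤ → ∣ p ∣ ℕ.+ ∣ q ∣ ≡ n
∣p∣+∣q∣≡n {n} {p} {q} p∩q≡⊥ p∪q≡⊤ = begin
  ∣ p ∣ ℕ.+ ∣ q ∣          ≡⟨ ∣p∣+∣q∣≡∣p∪q∣+∣p∩q∣ p q ⟩
  ∣ p ∪ q ∣ ℕ.+ ∣ p ∩ q ∣  ≡⟨ cong₂ (λ s t → ∣ s ∣ ℕ.+ ∣ t ∣) p∪q≡⊤ p∩q≡⊥ ⟩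
  ∣ ⊤ {n} ∣ ℕ.+ ∣ ⊥ {n} ∣  ≡⟨ cong₂ ℕ._+_ (∣⊤∣≡n n) (∣⊥∣≡0 n) ⟩
  n ℕ.+ 0                  ≡⟨ ℕ.+-identityʳ n ⟩
  n                        ∎
  where open ≡-Reasoning

𝟙 : Bool → ℚ
𝟙 true  = 1ℚ
𝟙 false = 0ℚ

sum-mono-≤ : ∀ {n} {f g : Fin n → ℚ} → (∀ i → f i ≤ g i) → sum f ≤ sum g
sum-mono-≤ {zero}  f≤g = ℚ.≤-refl
sum-mono-≤ {suc n} f≤g = ℚ.+-mono-≤ (f≤g zero) (sum-mono-≤ (f≤g ∘ suc))

∑𝟙≡ι∣p∣ : ∀ {n} (p : Subset n) → ∑[ x < n ] 𝟙 (lookup p x) ≡ ι ∣ p ∣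
∑𝟙≡ι∣p∣ []          = refl
∑𝟙≡ι∣p∣ (true  ∷ p) = trans (cong (1ℚ +_) (∑𝟙≡ι∣p∣ p)) (sym (ι-homo-+ 1 ∣ p ∣))
∑𝟙≡ι∣p∣ (false ∷ p) = trans (cong (0ℚ +_) (∑𝟙≡ι∣p∣ p)) (ℚ.+-identityˡ (ι ∣ p ∣))

∑𝟙*≡ι∣p∣* : ∀ {n} (p : Subset n) c → ∑[ x < n ] (𝟙 (lookup p x) * c) ≡ ι ∣ p ∣ * c
∑𝟙*≡ι∣p∣* p c = trans (sym (*-distribʳ-sum c (λ x → 𝟙 (lookup p x)))) (cong (_* c) (∑𝟙≡ι∣p∣ p))

∑𝟙*≤ι∣p∣* : ∀ {n} (p : Subset n) {f : Fin n → ℚ} {c : ℚ} → (∀ x → x ∈ p → f x ≤ c) →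
             ∑[ x < n ] (𝟙 (lookup p x) * f x) ≤ ι ∣ p ∣ * c
∑𝟙*≤ι∣p∣* {n} p {f} {c} f≤c = begin
  ∑[ x < n ] (𝟙 (lookup p x) * f x)  ≤⟨ sum-mono-≤ pointwise ⟩
  ∑[ x < n ] (𝟙 (lookup p x) * c)  ≡⟨ ∑𝟙*≡ι∣p∣* p c ⟩
  ι ∣ p ∣ * c                      ∎
  where
  open ℚ.≤-Reasoning
  pointwise : ∀ x → 𝟙 (lookup p x) * f x ≤ 𝟙 (lookup p x) * c
  pointwise x with lookup p x in px
  ... | true  = ℚ.*-monoˡ-≤-nonNeg 1ℚ (f≤c x (lookup⇒[]= x p px))
  ... | false = ℚ.≤-reflexive (trans (ℚ.*-zeroˡ (f x)) (sym (ℚ.*-zeroˡ c)))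

∑-atMostOne-≤1 : ∀ {m} (P : Fin m → Bool) {w : Fin m → ℚ} → (∀ {i j} → T (P i) → T (P j) → i ≡ j) →
                 (∀ i → T (P i) → w i ≤ 1ℚ) → ∑[ i < m ] (𝟙 (P i) * w i) ≤ 1ℚ
∑-atMostOne-≤1 {zero}  P unique w≤1 = ℚ.nonNegative⁻¹ 1ℚ
∑-atMostOne-≤1 {suc m} P {w} unique w≤1 with P zero in P₀
... | false = begin
  0ℚ * w zero + rest  ≡⟨ cong (_+ rest) (ℚ.*-zeroˡ (w zero)) ⟩
  0ℚ + rest           ≡⟨ ℚ.+-identityˡ rest ⟩
  rest                ≤⟨ ∑-atMostOne-≤1 (P ∘ suc) (λ Pᵢ Pⱼ → Fin.suc-injective (unique Pᵢ Pⱼ)) (w≤1 ∘ suc) ⟩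
  1ℚ                  ∎
  where
  open ℚ.≤-Reasoning
  rest = ∑[ i < m ] (𝟙 (P (suc i)) * w (suc i))
... | true  = begin
  1ℚ * w zero + ∑[ i < m ] (𝟙 (P (suc i)) * w (suc i))  ≡⟨ cong₂ _+_ (ℚ.*-identityˡ (w zero)) rest≡0 ⟩
  w zero + 0ℚ                                           ≡⟨ ℚ.+-identityʳ (w zero) ⟩
  w zero                                                ≤⟨ w≤1 zero (subst T (sym P₀) _) ⟩
  1ℚ                                                    ∎
  where
  open ℚ.≤-Reasoning
  term≡0 : ∀ i → 𝟙 (P (suc i)) * w (suc i) ≡ 0ℚ
  term≡0 i with P (suc i) in Pᵢ
  ... | false = ℚ.*-zeroˡ (w (suc i))
  ... | true  with () ← unique (subst T (sym P₀) _) (subst T (sym Pᵢ) _)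
  rest≡0 : ∑[ i < m ] (𝟙 (P (suc i)) * w (suc i)) ≡ 0ℚ
  rest≡0 = trans (sum-cong-≗ term≡0) (sum-replicate-zero m)

*-∑𝟙* : ∀ {m} c (P : Fin m → Bool) (f : Fin m → ℚ) →
        c * ∑[ i < m ] (𝟙 (P i) * f i) ≡ ∑[ i < m ] (𝟙 (P i) * (c * f i))
*-∑𝟙* c P f = trans (*-distribˡ-sum c (λ i → 𝟙 (P i) * f i)) (sum-cong-≗ λ i → x∙yz≈y∙xz c (𝟙 (P i)) (f i))

∑𝟙∑𝟙-swap : ∀ {m n} (P : Fin m → Bool) (s : Fin n → Bool) (Q : Fin m → Fin n → Bool) (f : Fin m → Fin n → ℚ) →
               ∑[ i < m ] (𝟙 (P i) * ∑[ x < n ] (𝟙 (s x ∧ Q i x) * f i x))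
             ≡ ∑[ x < n ] (𝟙 (s x) * ∑[ i < m ] (𝟙 (P i ∧ Q i x) * f i x))
∑𝟙∑𝟙-swap {m} {n} P s Q f = begin
  ∑[ i < m ] (𝟙 (P i) * ∑[ x < n ] (𝟙 (s x ∧ Q i x) * f i x))
    ≡⟨ sum-cong-≗ (λ i → *-∑𝟙* (𝟙 (P i)) (λ x → s x ∧ Q i x) (f i)) ⟩
  ∑[ i < m ] ∑[ x < n ] (𝟙 (s x ∧ Q i x) * (𝟙 (P i) * f i x))
    ≡⟨ sum-cong-≗ (λ i → sum-cong-≗ (λ x → exchange (P i) (s x) (Q i x) (f i x))) ⟩
  ∑[ i < m ] ∑[ x < n ] (𝟙 (P i ∧ Q i x) * (𝟙 (s x) * f i x))
    ≡⟨ ∑-comm (λ i x → 𝟙 (P i ∧ Q i x) * (𝟙 (s x) * f i x)) ⟩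
  ∑[ x < n ] ∑[ i < m ] (𝟙 (P i ∧ Q i x) * (𝟙 (s x) * f i x))
    ≡⟨ sum-cong-≗ (λ x → *-∑𝟙* (𝟙 (s x)) (λ i → P i ∧ Q i x) (λ i → f i x)) ⟨
  ∑[ x < n ] (𝟙 (s x) * ∑[ i < m ] (𝟙 (P i ∧ Q i x) * f i x))
    ∎
  where
  open ≡-Reasoning
  𝟙*[0*c]≡0 : ∀ q c → 𝟙 q * (0ℚ * c) ≡ 0ℚ
  𝟙*[0*c]≡0 q c = trans (cong (𝟙 q *_) (ℚ.*-zeroˡ c)) (ℚ.*-zeroʳ (𝟙 q))
  exchange : ∀ p s q c → 𝟙 (s ∧ q) * (𝟙 p * c) ≡ 𝟙 (p ∧ q) * (𝟙 s * c)
  exchange true  true  q c = refl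
  exchange false false q c = refl
  exchange true  false q c = trans (ℚ.*-zeroˡ (1ℚ * c)) (sym (𝟙*[0*c]≡0 q c))
  exchange false true  q c = trans (𝟙*[0*c]≡0 q c) (sym (ℚ.*-zeroˡ (1ℚ * c)))

module _ {n : ℕ} where

  binom∩ : Subset n → Subset n → Subset n → ℕ
  binom∩ A B S = (∣ A ∩ S ∣ ℕ.+ ∣ B ∩ S ∣) C ∣ A ∩ S ∣

  survives : Subset n → Subset n → Subset n → Fin n → Bool
  survives A B S x = (∣ B ∩ S ∣ ℕ.≡ᵇ 0) ∨ not (lookup A x)

  weight-comm : ∀ S₁ S₂ A B → weight S₁ S₂ A B ≡ weight S₂ S₁ A B
  weight-comm S₁ S₂ A B = cong recip (ℕ.*-comm (binom∩ A B S₁) (binom∩ A B S₂))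

  binom∩≡1 : ∀ A B S → ∣ B ∩ S ∣ ≡ 0 → binom∩ A B S ≡ 1
  binom∩≡1 A B S ∣B∩S∣≡0 rewrite ∣B∩S∣≡0 | ℕ.+-identityʳ ∣ A ∩ S ∣ = nCn≡1 ∣ A ∩ S ∣

  survives⇒∣B∩S∣≡0 : ∀ {A : Subset n} B S {x} → x ∈ A → T (survives A B S x) → ∣ B ∩ S ∣ ≡ 0
  survives⇒∣B∩S∣≡0 B S x∈A x-survives =
    ℕ.≡ᵇ⇒≡ ∣ B ∩ S ∣ 0 (subst T (∨-identityʳ _)
      (subst (λ a → T ((∣ B ∩ S ∣ ℕ.≡ᵇ 0) ∨ not a)) ([]=⇒lookup x∈A) x-survives))

  deletion-identity-empty : ∀ A B S → ∣ B ∩ S ∣ ≡ 0 →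
    ∑[ x < n ] (𝟙 (lookup S x ∧ survives A B S x) * recip (binom∩ A B (S - x))) ≡ ι ∣ S ∣ * recip (binom∩ A B S)
  deletion-identity-empty A B S ∣B∩S∣≡0 = trans (sum-cong-≗ term) (∑𝟙*≡ι∣p∣* S _)
    where
    term : ∀ x → 𝟙 (lookup S x ∧ survives A B S x) * recip (binom∩ A B (S - x)) ≡ 𝟙 (lookup S x) * recip (binom∩ A B S)
    term x = begin
      𝟙 (lookup S x ∧ survives A B S x) * recip (binom∩ A B (S - x))
        ≡⟨ cong₂ (λ b k → 𝟙 (lookup S x ∧ b) * recip k) survives≡true binom∩-unchanged ⟩
      𝟙 (lookup S x ∧ true) * recip (binom∩ A B S)
        ≡⟨ cong (λ b → 𝟙 b * recip (binom∩ A B S)) (∧-identityʳ (lookup S x)) ⟩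
      𝟙 (lookup S x) * recip (binom∩ A B S) ∎
      where
      open ≡-Reasoning
      survives≡true : survives A B S x ≡ true
      survives≡true = cong (λ k → (k ℕ.≡ᵇ 0) ∨ not (lookup A x)) ∣B∩S∣≡0
      binom∩-unchanged : binom∩ A B (S - x) ≡ binom∩ A B S
      binom∩-unchanged = trans (binom∩≡1 A B (S - x) (∣p∩q∣≡0⇒∣p∩[q-x]∣≡0 B S x ∣B∩S∣≡0))
                               (sym (binom∩≡1 A B S ∣B∩S∣≡0))

  -- With a = |A ∩ S| and |B ∩ S| = b + 1: deleting x ∈ B ∩ S leaves C(a+b, a), deleting
  -- x ∈ S ∖ (A ∪ B) leaves C(a+b+1, a), and x ∈ A ∩ S does not survive; absorption turns
  -- (b+1)/C(a+b, a) into (a+b+1)/C(a+b+1, a).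
  deletion-identity-nonempty : ∀ A B S {b} → Empty (A ∩ B) → ∣ B ∩ S ∣ ≡ suc b →
    ∑[ x < n ] (𝟙 (lookup S x ∧ survives A B S x) * recip (binom∩ A B (S - x))) ≡ ι ∣ S ∣ * recip (binom∩ A B S)
  deletion-identity-nonempty A B S {b} A∩B-empty ∣B∩S∣≡1+b = begin
    ∑[ x < n ] (𝟙 (lookup S x ∧ survives A B S x) * recip (binom∩ A B (S - x)))
      ≡⟨ sum-cong-≗ term ⟩
    ∑[ x < n ] (𝟙 (lookup (B ∩ S) x) * r′ + 𝟙 (lookup (∁ (A ∪ B) ∩ S) x) * r)
      ≡⟨ ∑-distrib-+ (λ x → 𝟙 (lookup (B ∩ S) x) * r′) (λ x → 𝟙 (lookup (∁ (A ∪ B) ∩ S) x) * r) ⟩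
    ∑[ x < n ] (𝟙 (lookup (B ∩ S) x) * r′) + ∑[ x < n ] (𝟙 (lookup (∁ (A ∪ B) ∩ S) x) * r)
      ≡⟨ cong₂ _+_ (∑𝟙*≡ι∣p∣* (B ∩ S) r′) (∑𝟙*≡ι∣p∣* (∁ (A ∪ B) ∩ S) r) ⟩
    ι ∣ B ∩ S ∣ * r′ + ι q * r
      ≡⟨ cong (λ k → ι k * r′ + ι q * r) ∣B∩S∣≡1+b ⟩
    ι (suc b) * r′ + ι q * r
      ≡⟨ cong (_+ ι q * r) absorption ⟩
    ι (a ℕ.+ suc b) * r + ι q * r
      ≡⟨ ℚ.*-distribʳ-+ r (ι (a ℕ.+ suc b)) (ι q) ⟨
    (ι (a ℕ.+ suc b) + ι q) * r
      ≡⟨ cong (_* r) (ι-homo-+ (a ℕ.+ suc b) q) ⟨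
    ι (a ℕ.+ suc b ℕ.+ q) * r
      ≡⟨ cong (λ k → ι k * r) ∣S∣-partition ⟨
    ι ∣ S ∣ * r ∎
    where
    open ≡-Reasoning
    a = ∣ A ∩ S ∣
    q = ∣ ∁ (A ∪ B) ∩ S ∣
    r = recip (binom∩ A B S)
    r′ = recip ((a ℕ.+ b) C a)
    ∣S∣-partition : ∣ S ∣ ≡ a ℕ.+ suc b ℕ.+ q
    ∣S∣-partition = trans (∣s∣≡∣p∩s∣+∣q∩s∣+∣∁[p∪q]∩s∣ S A∩B-empty) (cong (λ k → a ℕ.+ k ℕ.+ q) ∣B∩S∣≡1+b)
    absorption : ι (suc b) * r′ ≡ ι (a ℕ.+ suc b) * r
    absorption = trans (ι*recip-cross (suc b) (a ℕ.+ suc b) (C-nonZero a b) (C-nonZero a (suc b)) (C-absorption a b))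
                       (cong (λ k → ι (a ℕ.+ suc b) * recip ((a ℕ.+ k) C a)) (sym ∣B∩S∣≡1+b))
    term : ∀ x → 𝟙 (lookup S x ∧ survives A B S x) * recip (binom∩ A B (S - x))
               ≡ 𝟙 (lookup (B ∩ S) x) * r′ + 𝟙 (lookup (∁ (A ∪ B) ∩ S) x) * r
    term x rewrite cong (λ k → (k ℕ.≡ᵇ 0) ∨ not (lookup A x)) ∣B∩S∣≡1+b
                 | lookup-zipWith _∧_ x B S | lookup-zipWith _∧_ x (∁ (A ∪ B)) S
                 | lookup-map x not (A ∪ B) | lookup-zipWith _∨_ x A B
      with lookup S x in Sx | lookup A x in Ax | lookup B x in Bx
    ... | false | false | false = 0*≡0*+0* (recip (binom∩ A B (S - x))) r′ r
    ... | false | false | true  = 0*≡0*+0* (recip (binom∩ A B (S - x))) r′ r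
    ... | false | true  | false = 0*≡0*+0* (recip (binom∩ A B (S - x))) r′ r
    ... | false | true  | true  = 0*≡0*+0* (recip (binom∩ A B (S - x))) r′ r
    ... | true  | true  | true  = contradiction (x , x∈p∩q⁺ (lookup⇒[]= x A Ax , lookup⇒[]= x B Bx)) A∩B-empty
    ... | true  | true  | false = 0*≡0*+0* (recip (binom∩ A B (S - x))) r′ r
    ... | true  | false | true  = 1*≡1*+0* r (cong recip (cong₂ (λ i j → (i ℕ.+ j) C i) ∣A∩[S-x]∣≡a ∣B∩[S-x]∣≡b))
      where
      ∣A∩[S-x]∣≡a : ∣ A ∩ (S - x) ∣ ≡ a
      ∣A∩[S-x]∣≡a = x∉p∩q⇒∣p∩[q-x]∣≡∣p∩q∣ (lookup≡false⇒∉ Ax ∘ proj₁ ∘ x∈p∩q⁻ A S)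
      ∣B∩[S-x]∣≡b : ∣ B ∩ (S - x) ∣ ≡ b
      ∣B∩[S-x]∣≡b = ℕ.suc-injective (trans (sym (x∈p∩q⇒∣p∩q∣≡1+∣p∩[q-x]∣ x∈B∩S)) ∣B∩S∣≡1+b)
        where x∈B∩S = x∈p∩q⁺ (lookup⇒[]= x B Bx , lookup⇒[]= x S Sx)
    ... | true  | false | false = 1*≡0*+1* r′ (cong recip (cong₂ (λ i j → (i ℕ.+ j) C i) ∣A∩[S-x]∣≡a ∣B∩[S-x]∣≡∣B∩S∣))
      where
      ∣A∩[S-x]∣≡a : ∣ A ∩ (S - x) ∣ ≡ a
      ∣A∩[S-x]∣≡a = x∉p∩q⇒∣p∩[q-x]∣≡∣p∩q∣ (lookup≡false⇒∉ Ax ∘ proj₁ ∘ x∈p∩q⁻ A S)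
      ∣B∩[S-x]∣≡∣B∩S∣ : ∣ B ∩ (S - x) ∣ ≡ ∣ B ∩ S ∣
      ∣B∩[S-x]∣≡∣B∩S∣ = x∉p∩q⇒∣p∩[q-x]∣≡∣p∩q∣ (lookup≡false⇒∉ Bx ∘ proj₁ ∘ x∈p∩q⁻ B S)

  deletion-identity : ∀ A B S → Empty (A ∩ B) →
    ∑[ x < n ] (𝟙 (lookup S x ∧ survives A B S x) * recip (binom∩ A B (S - x))) ≡ ι ∣ S ∣ * recip (binom∩ A B S)
  deletion-identity A B S A∩B-empty with ∣ B ∩ S ∣ ℕ.≟ 0
  ... | yes ∣B∩S∣≡0 = deletion-identity-empty A B S ∣B∩S∣≡0
  ... | no  ∣B∩S∣≢0 = deletion-identity-nonempty A B S A∩B-empty (sym (ℕ.suc-pred _ {{ℕ.≢-nonZero ∣B∩S∣≢0}}))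

  deletion-identity-weight : ∀ (A B S₁ S₂ : Subset n) → Empty (A ∩ B) →
    ι ∣ S₂ ∣ * weight S₁ S₂ A B ≡ ∑[ x < n ] (𝟙 (lookup S₂ x ∧ survives A B S₂ x) * weight S₁ (S₂ - x) A B)
  deletion-identity-weight A B S₁ S₂ A∩B-empty = begin
    ι ∣ S₂ ∣ * recip (κ₁ ℕ.* binom∩ A B S₂)
      ≡⟨ cong (ι ∣ S₂ ∣ *_) (recip-homo-* κ₁ (binom∩ A B S₂)) ⟩
    ι ∣ S₂ ∣ * (recip κ₁ * recip (binom∩ A B S₂))
      ≡⟨ x∙yz≈y∙xz (ι ∣ S₂ ∣) (recip κ₁) (recip (binom∩ A B S₂)) ⟩
    recip κ₁ * (ι ∣ S₂ ∣ * recip (binom∩ A B S₂))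
      ≡⟨ cong (recip κ₁ *_) (deletion-identity A B S₂ A∩B-empty) ⟨
    recip κ₁ * ∑[ x < n ] (𝟙 (surv x) * recip (binom∩ A B (S₂ - x)))
      ≡⟨ *-∑𝟙* (recip κ₁) surv (λ x → recip (binom∩ A B (S₂ - x))) ⟩
    ∑[ x < n ] (𝟙 (surv x) * (recip κ₁ * recip (binom∩ A B (S₂ - x))))
      ≡⟨ sum-cong-≗ (λ x → cong (𝟙 (surv x) *_) (recip-homo-* κ₁ (binom∩ A B (S₂ - x)))) ⟨
    ∑[ x < n ] (𝟙 (surv x) * recip (κ₁ ℕ.* binom∩ A B (S₂ - x))) ∎
    where
    open ≡-Reasoning
    κ₁ = binom∩ A B S₁
    surv : Fin n → Bool
    surv x = lookup S₂ x ∧ survives A B S₂ x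

  -- A survivor with x ∈ A has B ∩ S₂ = ∅, so its S₂-factor is 1 and it is charged to S₁ alone.
  survivor-weight-split : ∀ (A B S₁ S₂ : Subset n) x p →
    𝟙 (p ∧ survives A B S₂ x) * weight S₁ (S₂ - x) A B
      ≤ 𝟙 (p ∧ (∣ B ∩ S₂ ∣ ℕ.≡ᵇ 0)) * recip (binom∩ A B S₁) + 𝟙 (p ∧ not (lookup A x)) * weight S₁ (S₂ - x) A B
  survivor-weight-split A B S₁ S₂ x false =
    ℚ.≤-reflexive (0*≡0*+0* (weight S₁ (S₂ - x) A B) (recip (binom∩ A B S₁)) (weight S₁ (S₂ - x) A B))
  survivor-weight-split A B S₁ S₂ x true with ∣ B ∩ S₂ ∣ in ∣B∩S₂∣≡b | lookup A x
  ... | zero  | true  = ℚ.≤-reflexive (1*≡1*+0* (weight S₁ (S₂ - x) A B) weight≡recip-binom∩)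
    where
    weight≡recip-binom∩ : weight S₁ (S₂ - x) A B ≡ recip (binom∩ A B S₁)
    weight≡recip-binom∩ = cong recip (trans (cong (binom∩ A B S₁ ℕ.*_) (binom∩≡1 A B (S₂ - x)
      (∣p∩q∣≡0⇒∣p∩[q-x]∣≡0 B S₂ x ∣B∩S₂∣≡b))) (ℕ.*-identityʳ (binom∩ A B S₁)))
  ... | zero  | false = p≤q+p (subst (0ℚ ≤_) (sym (ℚ.*-identityˡ (recip (binom∩ A B S₁)))) (recip-nonNeg (binom∩ A B S₁)))
  ... | suc _ | true  = ℚ.≤-reflexive (0*≡0*+0* (weight S₁ (S₂ - x) A B) (recip (binom∩ A B S₁)) (weight S₁ (S₂ - x) A B))
  ... | suc _ | false = ℚ.≤-reflexive (1*≡0*+1* {p = weight S₁ (S₂ - x) A B} (recip (binom∩ A B S₁)) refl)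

module _ {n m : ℕ} (A B : Fin m → Subset n) where

  -- Subfamilies are cut out by a Boolean selection P rather than reindexed.
  CrossIntersectingIn : Subset n → (Fin m → Bool) → Set
  CrossIntersectingIn S P = ∀ {i j} → T (P i) → T (P j) → i ≢ j → ∃[ y ] (y ∈ A i × y ∈ B j × y ∈ S)

  crossIntersecting-survivors : ∀ {S P} x → CrossIntersectingIn S P →
                                CrossIntersectingIn (S - x) (λ i → P i ∧ survives (A i) (B i) S x)
  crossIntersecting-survivors {S} x cross {i} {j} Pᵢ∧survᵢ Pⱼ∧survⱼ i≢j
    with Equivalence.to T-∧ Pᵢ∧survᵢ | Equivalence.to T-∧ Pⱼ∧survⱼ
  ... | Pᵢ , survᵢ | Pⱼ , _ with cross Pᵢ Pⱼ i≢j
  ... | y , y∈Aᵢ , y∈Bⱼ , y∈S with y Fin.≟ x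
  ... | no  y≢x  = y , y∈Aᵢ , y∈Bⱼ , x∈p∧x≢y⇒x∈p-y y∈S y≢x
  ... | yes refl with cross Pⱼ Pᵢ (i≢j ∘ sym)
  ... | _ , _ , z∈Bᵢ , z∈S =
    contradiction (x∈p∩q⁺ (z∈Bᵢ , z∈S)) (∣p∣≡0⇒x∉p (survives⇒∣B∩S∣≡0 (B i) S y∈Aᵢ survᵢ))

  crossIntersecting-x∉A : ∀ {S₁ S₂ P} x → CrossIntersectingIn (S₁ ∪ S₂) P →
                          CrossIntersectingIn (S₁ ∪ (S₂ - x)) (λ i → P i ∧ not (lookup (A i) x))
  crossIntersecting-x∉A {S₁} {S₂} x cross {i} Pᵢ∧x∉Aᵢ Pⱼ∧x∉Aⱼ i≢j
    with Equivalence.to T-∧ Pᵢ∧x∉Aᵢ | Equivalence.to T-∧ Pⱼ∧x∉Aⱼ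
  ... | Pᵢ , x∉Aᵢ | Pⱼ , _ with cross Pᵢ Pⱼ i≢j
  ... | y , y∈Aᵢ , y∈Bⱼ , y∈S₁∪S₂ =
    y , y∈Aᵢ , y∈Bⱼ , x∈p∪q⁺ (Sum.map₂ (λ y∈S₂ → x∈p∧x≢y⇒x∈p-y y∈S₂ y≢x) (x∈p∪q⁻ S₁ S₂ y∈S₁∪S₂))
    where
    y≢x : y ≢ x
    y≢x refl = lookup≡false⇒∉ (Equivalence.to T-not-≡ x∉Aᵢ) y∈Aᵢ

  crossIntersecting-B∩S₂≡∅ : ∀ {S₁ S₂ P} → CrossIntersectingIn (S₁ ∪ S₂) P →
                             CrossIntersectingIn S₁ (λ i → P i ∧ (∣ B i ∩ S₂ ∣ ℕ.≡ᵇ 0))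
  crossIntersecting-B∩S₂≡∅ {S₁} {S₂} cross {j = j} Pᵢ∧Bᵢ∩S₂≡∅ Pⱼ∧Bⱼ∩S₂≡∅ i≢j
    with Equivalence.to T-∧ Pᵢ∧Bᵢ∩S₂≡∅ | Equivalence.to T-∧ Pⱼ∧Bⱼ∩S₂≡∅
  ... | Pᵢ , _ | Pⱼ , Bⱼ∩S₂≡∅ with cross Pᵢ Pⱼ i≢j
  ... | y , y∈Aᵢ , y∈Bⱼ , y∈S₁∪S₂ with x∈p∪q⁻ S₁ S₂ y∈S₁∪S₂
  ... | inj₁ y∈S₁ = y , y∈Aᵢ , y∈Bⱼ , y∈S₁
  ... | inj₂ y∈S₂ = contradiction (x∈p∩q⁺ (y∈Bⱼ , y∈S₂)) (∣p∣≡0⇒x∉p (ℕ.≡ᵇ⇒≡ ∣ B j ∩ S₂ ∣ 0 Bⱼ∩S₂≡∅))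

  ∑recip-binom∩≤1 : (∀ i → Empty (A i ∩ B i)) → ∀ k S P → ∣ S ∣ ≡ k → CrossIntersectingIn S P →
                    ∑[ i < m ] (𝟙 (P i) * recip (binom∩ (A i) (B i) S)) ≤ 1ℚ
  ∑recip-binom∩≤1 _ zero S P ∣S∣≡0 cross =
    ∑-atMostOne-≤1 P at-most-one (λ i _ → recip-≤1 (binom∩ (A i) (B i) S))
    where
    at-most-one : ∀ {i j} → T (P i) → T (P j) → i ≡ j
    at-most-one {i} {j} Pᵢ Pⱼ with i Fin.≟ j
    ... | yes i≡j = i≡j
    ... | no  i≢j with cross Pᵢ Pⱼ i≢j
    ...   | _ , _ , _ , y∈S = contradiction y∈S (∣p∣≡0⇒x∉p ∣S∣≡0)
  ∑recip-binom∩≤1 disjoint (suc k) S P ∣S∣≡1+k cross = ι-cancelˡ-≤ k (begin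
    ι (suc k) * ∑[ i < m ] (𝟙 (P i) * w S i)
      ≡⟨ *-∑𝟙* (ι (suc k)) P (w S) ⟩
    ∑[ i < m ] (𝟙 (P i) * (ι (suc k) * w S i))
      ≡⟨ sum-cong-≗ (λ i → cong (𝟙 (P i) *_) (trans (cong (λ k → ι k * w S i) (sym ∣S∣≡1+k))
                                                      (sym (deletion-identity (A i) (B i) S (disjoint i))))) ⟩
    ∑[ i < m ] (𝟙 (P i) * ∑[ x < n ] (𝟙 (lookup S x ∧ surv i x) * w (S - x) i))
      ≡⟨ ∑𝟙∑𝟙-swap P (lookup S) surv (λ i x → w (S - x) i) ⟩
    ∑[ x < n ] (𝟙 (lookup S x) * ∑[ i < m ] (𝟙 (P i ∧ surv i x) * w (S - x) i))
      ≤⟨ ∑𝟙*≤ι∣p∣* S (λ x x∈S → ∑recip-binom∩≤1 disjoint k (S - x) _ (∣S-x∣≡k x∈S)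
                                                  (crossIntersecting-survivors x cross)) ⟩
    ι ∣ S ∣ * 1ℚ
      ≡⟨ cong (λ k → ι k * 1ℚ) ∣S∣≡1+k ⟩
    ι (suc k) * 1ℚ ∎)
    where
    open ℚ.≤-Reasoning
    w : Subset n → Fin m → ℚ
    w S i = recip (binom∩ (A i) (B i) S)
    surv : Fin m → Fin n → Bool
    surv i = survives (A i) (B i) S
    ∣S-x∣≡k : ∀ {x} → x ∈ S → ∣ S - x ∣ ≡ k
    ∣S-x∣≡k x∈S = ℕ.suc-injective (trans (sym (x∈p⇒∣p∣≡1+∣p-x∣ x∈S)) ∣S∣≡1+k)

  ∑weight≤1+∣S₂∣ : (∀ i → Empty (A i ∩ B i)) → ∀ k S₁ S₂ P → ∣ S₂ ∣ ≡ k → CrossIntersectingIn (S₁ ∪ S₂) P →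
                   ∑[ i < m ] (𝟙 (P i) * weight S₁ S₂ (A i) (B i)) ≤ ι (suc k)
  ∑weight≤1+∣S₂∣ disjoint zero S₁ S₂ P ∣S₂∣≡0 cross = begin
    ∑[ i < m ] (𝟙 (P i) * weight S₁ S₂ (A i) (B i))
      ≡⟨ sum-cong-≗ (λ i → cong (λ k → 𝟙 (P i) * recip k) (binom∩₁*binom∩₂≡binom∩₁ i)) ⟩
    ∑[ i < m ] (𝟙 (P i) * recip (binom∩ (A i) (B i) S₁))
      ≤⟨ ∑recip-binom∩≤1 disjoint ∣ S₁ ∣ S₁ P refl cross₁ ⟩
    1ℚ ∎
    where
    open ℚ.≤-Reasoning
    binom∩₁*binom∩₂≡binom∩₁ : ∀ i → binom∩ (A i) (B i) S₁ ℕ.* binom∩ (A i) (B i) S₂ ≡ binom∩ (A i) (B i) S₁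
    binom∩₁*binom∩₂≡binom∩₁ i = trans (cong (binom∩ (A i) (B i) S₁ ℕ.*_) (binom∩≡1 (A i) (B i) S₂ ∣Bᵢ∩S₂∣≡0))
                                      (ℕ.*-identityʳ (binom∩ (A i) (B i) S₁))
      where
      ∣Bᵢ∩S₂∣≡0 : ∣ B i ∩ S₂ ∣ ≡ 0
      ∣Bᵢ∩S₂∣≡0 = ℕ.n≤0⇒n≡0 (subst (∣ B i ∩ S₂ ∣ ℕ.≤_) ∣S₂∣≡0 (∣p∩q∣≤∣q∣ (B i) S₂))
    cross₁ : CrossIntersectingIn S₁ P
    cross₁ = subst (λ S → CrossIntersectingIn S P) (trans (cong (S₁ ∪_) (∣p∣≡0⇒p≡⊥ ∣S₂∣≡0)) (∪-identityʳ S₁)) cross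
  ∑weight≤1+∣S₂∣ disjoint (suc k) S₁ S₂ P ∣S₂∣≡1+k cross = ι-cancelˡ-≤ k (begin
    ι (suc k) * ∑[ i < m ] (𝟙 (P i) * w S₂ i)
      ≡⟨ *-∑𝟙* (ι (suc k)) P (w S₂) ⟩
    ∑[ i < m ] (𝟙 (P i) * (ι (suc k) * w S₂ i))
      ≡⟨ sum-cong-≗ (λ i → cong (𝟙 (P i) *_) (trans (cong (λ k → ι k * w S₂ i) (sym ∣S₂∣≡1+k))
                                                      (deletion-identity-weight (A i) (B i) S₁ S₂ (disjoint i)))) ⟩
    ∑[ i < m ] (𝟙 (P i) * ∑[ x < n ] (𝟙 (lookup S₂ x ∧ surv i x) * w (S₂ - x) i))
      ≡⟨ ∑𝟙∑𝟙-swap P (lookup S₂) surv (λ i x → w (S₂ - x) i) ⟩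
    ∑[ x < n ] (𝟙 (lookup S₂ x) * ∑[ i < m ] (𝟙 (P i ∧ surv i x) * w (S₂ - x) i))
      ≤⟨ ∑𝟙*≤ι∣p∣* S₂ survivors-bound ⟩
    ι ∣ S₂ ∣ * (1ℚ + ι (suc k))
      ≡⟨ cong₂ _*_ (cong ι ∣S₂∣≡1+k) (sym (ι-homo-+ 1 (suc k))) ⟩
    ι (suc k) * ι (suc (suc k)) ∎)
    where
    open ℚ.≤-Reasoning
    w : Subset n → Fin m → ℚ
    w S i = weight S₁ S (A i) (B i)
    surv : Fin m → Fin n → Bool
    surv i = survives (A i) (B i) S₂
    survivors-bound : ∀ x → x ∈ S₂ → ∑[ i < m ] (𝟙 (P i ∧ surv i x) * w (S₂ - x) i) ≤ 1ℚ + ι (suc k)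
    survivors-bound x x∈S₂ = begin
      ∑[ i < m ] (𝟙 (P i ∧ surv i x) * w (S₂ - x) i)
        ≤⟨ sum-mono-≤ (λ i → survivor-weight-split (A i) (B i) S₁ S₂ x (P i)) ⟩
      ∑[ i < m ] (𝟙 (P i ∧ (∣ B i ∩ S₂ ∣ ℕ.≡ᵇ 0)) * recip (binom∩ (A i) (B i) S₁)
                  + 𝟙 (P i ∧ not (lookup (A i) x)) * w (S₂ - x) i)
        ≡⟨ ∑-distrib-+ (λ i → 𝟙 (P i ∧ (∣ B i ∩ S₂ ∣ ℕ.≡ᵇ 0)) * recip (binom∩ (A i) (B i) S₁))
                       (λ i → 𝟙 (P i ∧ not (lookup (A i) x)) * w (S₂ - x) i) ⟩
      ∑[ i < m ] (𝟙 (P i ∧ (∣ B i ∩ S₂ ∣ ℕ.≡ᵇ 0)) * recip (binom∩ (A i) (B i) S₁))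
        + ∑[ i < m ] (𝟙 (P i ∧ not (lookup (A i) x)) * w (S₂ - x) i)
        ≤⟨ ℚ.+-mono-≤ (∑recip-binom∩≤1 disjoint ∣ S₁ ∣ S₁ _ refl (crossIntersecting-B∩S₂≡∅ cross))
                      (∑weight≤1+∣S₂∣ disjoint k S₁ (S₂ - x) _ ∣S₂-x∣≡k (crossIntersecting-x∉A x cross)) ⟩
      1ℚ + ι (suc k) ∎
      where
      ∣S₂-x∣≡k : ∣ S₂ - x ∣ ≡ k
      ∣S₂-x∣≡k = ℕ.suc-injective (trans (sym (x∈p⇒∣p∣≡1+∣p-x∣ x∈S₂)) ∣S₂∣≡1+k)

  isBollobas⇒crossIntersecting : IsBollobas A B → CrossIntersectingIn ⊤ (λ _ → true)
  isBollobas⇒crossIntersecting (_ , A∩B-empty⇒≡) {i} {j} _ _ i≢j with nonempty? (A i ∩ B j)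
  ... | yes (y , y∈Aᵢ∩Bⱼ) = let y∈Aᵢ , y∈Bⱼ = x∈p∩q⁻ (A i) (B j) y∈Aᵢ∩Bⱼ in y , y∈Aᵢ , y∈Bⱼ , ∈⊤
  ... | no  Aᵢ∩Bⱼ-empty   = contradiction (A∩B-empty⇒≡ i j Aᵢ∩Bⱼ-empty) i≢j

∑≡sum : ∀ m (f : Fin m → ℚ) → ∑ m f ≡ ∑[ i < m ] f i
∑≡sum zero    f = refl
∑≡sum (suc m) f = cong (f zero +_) (trans
  (cong (List.foldr _+_ 0ℚ) (trans (List.map-tabulate suc f) (sym (List.map-tabulate id (f ∘ suc)))))
  (∑≡sum m (f ∘ suc)))

m≤n⇒m≤[m+n]/2 : ∀ {m n} → m ℕ.≤ n → m ℕ.≤ (m ℕ.+ n) ℕ./ 2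
m≤n⇒m≤[m+n]/2 {m} {n} m≤n = subst (ℕ._≤ (m ℕ.+ n) ℕ./ 2) (ℕ.m*n/n≡m m 2)
  (ℕ./-monoˡ-≤ 2 (subst (ℕ._≤ m ℕ.+ n) (sym m*2≡m+m) (ℕ.+-monoʳ-≤ m m≤n)))
  where
  m*2≡m+m : m ℕ.* 2 ≡ m ℕ.+ m
  m*2≡m+m = trans (ℕ.*-comm m 2) (cong (m ℕ.+_) (ℕ.+-identityʳ m))

≤ι[1+a]∧≤ι[1+b]⇒≤ι[1+[a+b]/2] : ∀ {q} a b → q ≤ ι (suc a) → q ≤ ι (suc b) →
                                q ≤ ι (suc ((a ℕ.+ b) ℕ./ 2))
≤ι[1+a]∧≤ι[1+b]⇒≤ι[1+[a+b]/2] a b q≤1+a q≤1+b with ℕ.≤-total a b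
... | inj₁ a≤b = ℚ.≤-trans q≤1+a (ι-mono-≤ (ℕ.s≤s (m≤n⇒m≤[m+n]/2 a≤b)))
... | inj₂ b≤a = ℚ.≤-trans q≤1+b (ι-mono-≤ (ℕ.s≤s (subst (λ k → b ℕ.≤ k ℕ./ 2) (ℕ.+-comm b a)
                                                        (m≤n⇒m≤[m+n]/2 b≤a))))

theorem1p8 : (n m : ℕ) (X₁ X₂ : Subset n) → X₁ ∩ X₂ ≡ ⊥ → X₁ ∪ X₂ ≡ ⊤ →
    (A B : Fin m → Subset n) → IsBollobas A B →
    ∑ m (λ i → weight X₁ X₂ (A i) (B i)) ≤ bound n
theorem1p8 n m X₁ X₂ X₁∩X₂≡⊥ X₁∪X₂≡⊤ A B isBollobas = begin
  ∑ m (λ i → weight X₁ X₂ (A i) (B i))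
    ≡⟨ ∑≡sum m (λ i → weight X₁ X₂ (A i) (B i)) ⟩
  ∑[ i < m ] weight X₁ X₂ (A i) (B i)
    ≡⟨ sum-cong-≗ (λ i → ℚ.*-identityˡ (weight X₁ X₂ (A i) (B i))) ⟨
  ∑[ i < m ] (𝟙 true * weight X₁ X₂ (A i) (B i))
    ≤⟨ ≤ι[1+a]∧≤ι[1+b]⇒≤ι[1+[a+b]/2] ∣ X₁ ∣ ∣ X₂ ∣ bound₂₁ bound₁₂ ⟩
  ι (suc ((∣ X₁ ∣ ℕ.+ ∣ X₂ ∣) ℕ./ 2))
    ≡⟨ cong (λ k → ι (suc (k ℕ./ 2))) (∣p∣+∣q∣≡n X₁∩X₂≡⊥ X₁∪X₂≡⊤) ⟩
  bound n ∎
  where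
  open ℚ.≤-Reasoning
  cross : ∀ {S₁ S₂} → S₁ ∪ S₂ ≡ ⊤ → CrossIntersectingIn A B (S₁ ∪ S₂) (λ _ → true)
  cross S₁∪S₂≡⊤ = subst (λ S → CrossIntersectingIn A B S (λ _ → true)) (sym S₁∪S₂≡⊤)
                        (isBollobas⇒crossIntersecting A B isBollobas)
  bound₁₂ : ∑[ i < m ] (𝟙 true * weight X₁ X₂ (A i) (B i)) ≤ ι (suc ∣ X₂ ∣)
  bound₁₂ = ∑weight≤1+∣S₂∣ A B (proj₁ isBollobas) _ X₁ X₂ _ refl (cross X₁∪X₂≡⊤)
  bound₂₁ : ∑[ i < m ] (𝟙 true * weight X₁ X₂ (A i) (B i)) ≤ ι (suc ∣ X₁ ∣)
  bound₂₁ = subst (_≤ ι (suc ∣ X₁ ∣)) (sum-cong-≗ (λ i → cong (𝟙 true *_) (weight-comm X₂ X₁ (A i) (B i))))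
                  (∑weight≤1+∣S₂∣ A B (proj₁ isBollobas) _ X₂ X₁ _ refl (cross (trans (∪-comm X₂ X₁) X₁∪X₂≡⊤)))
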